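{- Let $G$ be a finite group, $(C_1,\dots,C_m)$ a class vector of $G$, and let $F\le H_m$ be a subgroup such that $$[\underline\sigma]^{\beta_{ij}\varphi}=[\underline\sigma]^{\varphi\beta_{ij}}$$ for all $1\le i<j\le m$, all $\varphi\in F$ and all $[\underline\sigma]\in\Sigma^i(C_1,\dots,C_m)^{sy}$. Then the set of fixed points of $F$ in $\Sigma^i(C_1,\dots,C_m)$, namely $\{[\underline\sigma]\in\Sigma^i(C_1,\dots,C_m)\mid [\underline\sigma]^\varphi=[\underline\sigma]\ \forall\varphi\in F\}$, is invariant under $B_m$ (so $B_m$ acts on it).
   Context: For a finite group $G$ with identity $\iota$, $\Sigma^i(C_1,\dots,C_m)$ is the set of classes $[\sigma_1,\dots,\sigma_m]$, modulo simultaneous conjugation by $G$, of tuples with $\sigma_i$ in the conjugacy class $C_i$, $\langle\sigma_1,\dots,\sigma_m\rangle=G$ and $\sigma_1\cdots\sigma_m=\iota$; $\Sigma^i(C_1,\dots,C_m)^{sy}=\bigcup_{\pi\in S_m}\Sigma^i(C_{\pi(1)},\dots,C_{\pi(m)})$. The full Hurwitz braid group $H_m=\langle\beta_2,\dots,\beta_m\rangle$ (relations $\beta_i\beta_j=\beta_j\beta_i$ for $|i-j|>1$, $\beta_i\beta_{i+1}\beta_i=\beta_{i+1}\beta_i\beta_{i+1}$, $\beta_2\cdots\beta_{m-1}\beta_m^2\beta_{m-1}\cdots\beta_2=\iota$) acts on the right on $\Sigma^i(C_1,\dots,C_m)^{sy}$ by $[\underline\sigma]^{\beta_i}=[\sigma_1,\dots,\sigma_{i-2},\sigma_{i-1}\sigma_i\sigma_{i-1}^{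 -1},\sigma_{i-1},\sigma_{i+1},\dots,\sigma_m]$. The pure Hurwitz braid group $B_m$, generated by $\beta_{ij}=\beta_{i+1}^{ -1}\cdots\beta_{j-1}^{ -1}\beta_j^2\beta_{j-1}\cdots\beta_{i+1}$ ($1\le i<j\le m$), preserves $\Sigma^i(C_1,\dots,C_m)$. -}

module Defs where

open import Level using (Level; _⊔_) renaming (suc to lsuc)
open import Algebra.Bundles using (Group)
open import Data.Nat as ℕ using (ℕ; zero; suc; pred)
open import Data.Nat.Properties using (_≤?_; _<?_; _≟_)
open import Data.Fin as Fin using (Fin; toℕ)
open import Data.Fin.Permutation using (Permutation′; _⟨$⟩ʳ_)
open import Data.Vec using (Vec; []; _∷_; lookup)
open import Data.List as List using (List; []; _∷_; _++_; map; reverse; filter; foldl; allFin)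
open import Data.Bool using (Bool; true; false; not)
open import Data.Product using (Σ; ∃; _×_; _,_)
open import Relation.Nullary.Decidable using (_×-dec_)
open import Relation.Binary.PropositionalEquality using (_≡_)

-- The full Hurwitz braid group H_m, as words in the generators modulo
-- the defining relations.
-- A letter (letter j true) stands for β_{toℕ j + 2}, (letter j false) for its inverse;
-- so the generators β_2, …, β_m are indexed by Fin (pred m).

data Letter (m : ℕ) : Set where
  letter : Fin (pred m) → Bool → Letter m

Word : ℕ → Set
Word m = List (Letter m)

pos : ∀ {m} → Fin (pred m) → Letter m
pos j = letter j true

neg : ∀ {m} → Fin (pred m) → Letter m
neg j = letter j false

invWord : ∀ {m} → Word m → Word m
invWord w = reverse (map invLetter w)
  where
  invLetter : Letter _ → Letter _
  invLetter (letter j b) = letter j (not b)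

hurwitzWord : ∀ m → Word m
hurwitzWord m = map (pos {m}) (allFin (pred m) ++ reverse (allFin (pred m)))

data _≈H_ {m : ℕ} : Word m → Word m → Set where
  ≈H-refl  : ∀ {u} → u ≈H u
  ≈H-sym   : ∀ {u v} → u ≈H v → v ≈H u
  ≈H-trans : ∀ {u v w} → u ≈H v → v ≈H w → u ≈H w
  ≈H-cong  : ∀ {u u′ v v′} → u ≈H u′ → v ≈H v′ → (u ++ v) ≈H (u′ ++ v′)
  ≈H-cancel : ∀ (j : Fin (pred m)) b → (letter j b ∷ letter j (not b) ∷ []) ≈H []
  ≈H-far   : ∀ (j k : Fin (pred m)) → suc (toℕ j) ℕ.< toℕ k →
             (pos {m} j ∷ pos k ∷ []) ≈H (pos k ∷ pos j ∷ [])
  ≈H-braid : ∀ (j k : Fin (pred m)) → toℕ k ≡ suc (toℕ j) →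
             (pos {m} j ∷ pos k ∷ pos j ∷ []) ≈H (pos k ∷ pos j ∷ pos k ∷ [])
  ≈H-hurwitz : hurwitzWord m ≈H []

record Subgroup (f : Level) (m : ℕ) : Set (lsuc f) where
  field
    Mem    : Word m → Set f
    ε-mem  : Mem []
    ∙-mem  : ∀ {u v} → Mem u → Mem v → Mem (u ++ v)
    ⁻¹-mem : ∀ {u} → Mem u → Mem (invWord u)
    resp   : ∀ {u v} → u ≈H v → Mem u → Mem v

-- The pure braid β_{ij} = β_{i+1}⁻¹ ⋯ β_{j-1}⁻¹ β_j² β_{j-1} ⋯ β_{i+1},
-- for positions i < j given 0-based as elements of Fin m
-- (so i , j : Fin m correspond to the indices toℕ i + 1 , toℕ j + 1).
pureWord : ∀ {m} → Fin m → Fin m → Word m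
pureWord {m} i j =
  map (neg {m}) mid ++ map (pos {m}) top ++ map (pos {m}) top ++ reverse (map (pos {m}) mid)
  where
  mid : List (Fin (pred m))
  mid = filter (λ k → (toℕ i ≤? toℕ k) ×-dec (suc (toℕ k) <? toℕ j)) (allFin (pred m))
  top : List (Fin (pred m))
  top = filter (λ k → suc (toℕ k) ≟ toℕ j) (allFin (pred m))

data InB {m : ℕ} : Word m → Set where
  B-ε   : InB []
  B-gen : ∀ (i j : Fin m) {w} → i Fin.< j → InB w → InB (pureWord i j ++ w)
  B-inv : ∀ (i j : Fin m) {w} → i Fin.< j → InB w → InB (invWord (pureWord i j) ++ w)

module GroupDefs {c ℓ : Level} (G : Group c ℓ) where
  open Group G

  Finite : Set (c ⊔ ℓ)
  Finite = ∃ λ (n : ℕ) → ∃ λ (f : Fin n → Carrier) → ∀ x → ∃ λ i → f i ≈ x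

  InClass : Carrier → Carrier → Set (c ⊔ ℓ)
  InClass x c₀ = ∃ λ g → x ≈ g ∙ c₀ ∙ g ⁻¹

  data Gen {n : ℕ} (σ : Vec Carrier n) : Carrier → Set (c ⊔ ℓ) where
    gen-el  : ∀ p → Gen σ (lookup σ p)
    gen-ε   : Gen σ ε
    gen-∙   : ∀ {x y} → Gen σ x → Gen σ y → Gen σ (x ∙ y)
    gen-⁻¹  : ∀ {x} → Gen σ x → Gen σ (x ⁻¹)
    gen-≈   : ∀ {x y} → x ≈ y → Gen σ x → Gen σ y

  prod : ∀ {n} → Vec Carrier n → Carrier
  prod [] = ε
  prod (x ∷ xs) = x ∙ prod xs

  _~_ : ∀ {n} → Vec Carrier n → Vec Carrier n → Set (c ⊔ ℓ)
  σ ~ τ = ∃ λ g → ∀ p → lookup τ p ≈ g ∙ lookup σ p ∙ g ⁻¹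

  -- a tuple representing an element of Σ^i(C₁,…,C_m); the class vector
  -- C is given by representatives of the conjugacy classes
  InΣ : ∀ {m} → Vec Carrier m → Vec Carrier m → Set (c ⊔ ℓ)
  InΣ C σ = (∀ p → InClass (lookup σ p) (lookup C p))
          × (∀ x → Gen σ x)
          × (prod σ ≈ ε)

  InΣsy : ∀ {m} → Vec Carrier m → Vec Carrier m → Set (c ⊔ ℓ)
  InΣsy {m} C σ = ∃ λ (π : Permutation′ m) →
            (∀ p → InClass (lookup σ p) (lookup C (π ⟨$⟩ʳ p)))
          × (∀ x → Gen σ x)
          × (prod σ ≈ ε)

  -- action of a single letter: position k (0-based) is β_{k+2}
  actLetter : ∀ {n} → ℕ → Bool → Vec Carrier n → Vec Carrier n
  actLetter zero true  (x ∷ y ∷ xs) = (x ∙ y ∙ x ⁻¹) ∷ x ∷ xs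
  actLetter zero false (x ∷ y ∷ xs) = y ∷ (y ⁻¹ ∙ x ∙ y) ∷ xs
  actLetter (suc k) b (x ∷ xs) = x ∷ actLetter k b xs
  actLetter _ _ xs = xs

  -- right action of a word: act (u ++ v) σ = act v (act u σ), i.e. σ^{uv}
  act : ∀ {m} → Word m → Vec Carrier m → Vec Carrier m
  act w σ = foldl step σ w
    where
    step : Vec Carrier _ → Letter _ → Vec Carrier _
    step τ (letter j b) = actLetter (toℕ j) b τ

  Fixed : ∀ {f m} → Subgroup f m → Vec Carrier m → Set (c ⊔ ℓ ⊔ f)
  Fixed F σ = ∀ φ → Subgroup.Mem F φ → act φ σ ~ σ

-- Each letter of a braid word acts on a tuple by a Hurwitz move, which preserves the product and the
-- generated subgroup, moves the conjugacy classes of the entries by a transposition of positions, and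
-- commutes with simultaneous conjugation, so words act on classes [σ]. The pure braid β_ij = u β_j² u⁻¹
-- induces the identity permutation of positions, hence β_ij and its inverse map Σ^i(C₁,…,C_m) to itself.
-- If β_ij commutes with every φ ∈ F at σ, then σ is fixed by F iff σ^β_ij is; the hypothesis provides
-- this commutation on all of Σ^i(C₁,…,C_m), and induction along a word of B_m finishes the proof.
module Submission where

open import Defs
open import Level using (Level)
open import Algebra.Bundles using (Group)
open import Data.Nat using (ℕ)
open import Data.Fin using (Fin; _<_)
open import Data.Vec using (Vec)
open import Data.List using (_++_)
open import Data.Product using (_×_)

open import Level using (_⊔_)
open import Data.Bool using (true; false; not)
open import Data.Nat using (zero; suc; pred; _≤?_; _<?_; _≟_)
open import Data.Fin using (toℕ; zero; suc)
import Data.Fin.Permutation as Permutation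
open import Data.Product using (∃; _,_)
open import Data.List using (List; []; _∷_; map; reverse; filter; allFin)
open import Data.List.Properties using (unfold-reverse; map-cong; ++-assoc)
open import Data.List.Relation.Unary.All as All using (All; []; _∷_)
open import Data.List.Relation.Unary.All.Properties using (all-filter; map⁺)
open import Data.Vec using ([]; _∷_; lookup)
open import Data.Vec.Relation.Binary.Pointwise.Inductive as Pointwise using (Pointwise; []; _∷_)
import Data.Vec.Relation.Binary.Pointwise.Extensional as Extensional
open import Relation.Nullary.Decidable using (_×-dec_)
open import Relation.Binary.Bundles using (Setoid)
import Relation.Binary.Reasoning.Setoid as SetoidReasoning
open import Relation.Binary.PropositionalEquality as ≡ using (_≡_)

invLetter : ∀ {m} → Letter m → Letter m
invLetter (letter j b) = letter j (not b)

-- invWord inverts letters by a local copy of invLetter, which map-cong identifies with this one.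
invWord-∷ : ∀ {m} (l : Letter m) (w : Word m) → invWord (l ∷ w) ≡ invWord w ++ invLetter l ∷ []
invWord-∷ l w =
  ≡.trans (≡.cong reverse (map-cong (λ { (letter _ _) → ≡.refl }) (l ∷ w)))
    (≡.trans (unfold-reverse (invLetter l) (map invLetter w))
      (≡.cong (λ v → reverse v ++ invLetter l ∷ []) (≡.sym (map-cong (λ { (letter _ _) → ≡.refl }) w))))

invWord-map-neg : ∀ {m} (ks : List (Fin (pred m))) → invWord (map (neg {m}) ks) ≡ reverse (map pos ks)
invWord-map-neg [] = ≡.refl
invWord-map-neg (k ∷ ks) = ≡.trans (invWord-∷ (neg k) (map neg ks))
  (≡.trans (≡.cong (_++ pos k ∷ []) (invWord-map-neg ks)) (≡.sym (unfold-reverse (pos k) (map pos ks))))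

position : ∀ {m} → Letter m → ℕ
position (letter j _) = toℕ j

module _ {a} {A : Set a} where

  swapAt : ∀ {n} → ℕ → Vec A n → Vec A n
  swapAt zero    (x ∷ y ∷ xs) = y ∷ x ∷ xs
  swapAt (suc k) (x ∷ xs)     = x ∷ swapAt k xs
  swapAt _       xs           = xs

  swapAt-involutive : ∀ {n} k (xs : Vec A n) → swapAt k (swapAt k xs) ≡ xs
  swapAt-involutive zero    []           = ≡.refl
  swapAt-involutive zero    (x ∷ [])     = ≡.refl
  swapAt-involutive zero    (x ∷ y ∷ xs) = ≡.refl
  swapAt-involutive (suc k) []           = ≡.refl
  swapAt-involutive (suc k) (x ∷ xs)     = ≡.cong (x ∷_) (swapAt-involutive k xs)

  permute : ∀ {m n} → Word m → Vec A n → Vec A n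
  permute []               xs = xs
  permute (letter j _ ∷ w) xs = permute w (swapAt (toℕ j) xs)

  permute-++ : ∀ {m n} (u v : Word m) (xs : Vec A n) → permute (u ++ v) xs ≡ permute v (permute u xs)
  permute-++ []               v xs = ≡.refl
  permute-++ (letter j _ ∷ u) v xs = permute-++ u v (swapAt (toℕ j) xs)

  permute-invWord : ∀ {m n} (w : Word m) (xs : Vec A n) → permute (invWord w) (permute w xs) ≡ xs
  permute-invWord []                   xs = ≡.refl
  permute-invWord {n = n} (l@(letter j _) ∷ w) xs = begin
    permute (invWord (l ∷ w)) (permute w ys)
      ≡⟨ ≡.cong (λ u → permute u (permute w ys)) (invWord-∷ l w) ⟩
    permute (invWord w ++ invLetter l ∷ []) (permute w ys)
      ≡⟨ permute-++ (invWord w) (invLetter l ∷ []) (permute w ys) ⟩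
    swapAt (toℕ j) (permute (invWord w) (permute w ys))
      ≡⟨ ≡.cong (swapAt (toℕ j)) (permute-invWord w ys) ⟩
    swapAt (toℕ j) ys
      ≡⟨ swapAt-involutive (toℕ j) xs ⟩
    xs ∎
    where
    open ≡.≡-Reasoning
    ys : Vec A n
    ys = swapAt (toℕ j) xs

  permute-swapAt-comm : ∀ {m n t} (w : Word m) → All (λ l → position l ≡ t) w → (xs : Vec A n) →
                        permute w (swapAt t xs) ≡ swapAt t (permute w xs)
  permute-swapAt-comm []              []            xs = ≡.refl
  permute-swapAt-comm (letter j _ ∷ w) (≡.refl ∷ ps) xs = permute-swapAt-comm w ps (swapAt (toℕ j) xs)

  permute-constant-involutive : ∀ {m n t} (w : Word m) → All (λ l → position l ≡ t) w → (xs : Vec A n) →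
                                permute w (permute w xs) ≡ xs
  permute-constant-involutive []               []            xs = ≡.refl
  permute-constant-involutive (letter j _ ∷ w) (≡.refl ∷ ps) xs = begin
    permute w (swapAt (toℕ j) (permute w (swapAt (toℕ j) xs)))
      ≡⟨ ≡.cong (permute w) (≡.sym (permute-swapAt-comm w ps (swapAt (toℕ j) xs))) ⟩
    permute w (permute w (swapAt (toℕ j) (swapAt (toℕ j) xs)))
      ≡⟨ ≡.cong (λ ys → permute w (permute w ys)) (swapAt-involutive (toℕ j) xs) ⟩
    permute w (permute w xs)
      ≡⟨ permute-constant-involutive w ps xs ⟩
    xs ∎
    where open ≡.≡-Reasoning

  permute-conjugate : ∀ {m n} (u v : Word m) → (∀ (ys : Vec A n) → permute v ys ≡ ys) →
                      (xs : Vec A n) → permute (u ++ v ++ invWord u) xs ≡ xs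
  permute-conjugate u v v-trivial xs = begin
    permute (u ++ v ++ invWord u) xs                  ≡⟨ permute-++ u (v ++ invWord u) xs ⟩
    permute (v ++ invWord u) (permute u xs)           ≡⟨ permute-++ v (invWord u) (permute u xs) ⟩
    permute (invWord u) (permute v (permute u xs))    ≡⟨ ≡.cong (permute (invWord u)) (v-trivial (permute u xs)) ⟩
    permute (invWord u) (permute u xs)                ≡⟨ permute-invWord u xs ⟩
    xs                                                ∎
    where open ≡.≡-Reasoning

  -- β_ij = u β_j² u⁻¹ with u = β_{i+1}⁻¹ ⋯ β_{j-1}⁻¹, and β_j² induces the identity permutation.
  permute-pureWord : ∀ {m n} (i j : Fin m) (xs : Vec A n) → permute (pureWord i j) xs ≡ xs
  permute-pureWord {m} i j xs = begin
    permute (u ++ t ++ t ++ reverse (map pos mid)) xs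
      ≡⟨ ≡.cong (λ v → permute (u ++ t ++ t ++ v) xs) (invWord-map-neg mid) ⟨
    permute (u ++ t ++ t ++ invWord u) xs
      ≡⟨ ≡.cong (λ v → permute (u ++ v) xs) (++-assoc t t (invWord u)) ⟨
    permute (u ++ (t ++ t) ++ invWord u) xs
      ≡⟨ permute-conjugate u (t ++ t) t²-trivial xs ⟩
    xs ∎
    where
    open ≡.≡-Reasoning
    mid top : List (Fin (pred m))
    mid = filter (λ k → (toℕ i ≤? toℕ k) ×-dec (suc (toℕ k) <? toℕ j)) (allFin (pred m))
    top = filter (λ k → suc (toℕ k) ≟ toℕ j) (allFin (pred m))
    u t : Word m
    u = map neg mid
    t = map pos top
    t²-trivial : ∀ ys → permute (t ++ t) ys ≡ ys
    t²-trivial ys = ≡.trans (permute-++ t t ys) (permute-constant-involutive t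
      (map⁺ (All.map (≡.cong pred) (all-filter (λ k → suc (toℕ k) ≟ toℕ j) (allFin (pred m))))) ys)

module HurwitzAction {c ℓ} (G : Group c ℓ) where
  open Group G
  open GroupDefs G
  open import Algebra.Properties.Group G using (⁻¹-involutive; ⁻¹-anti-homo-∙; ε⁻¹≈ε; \\-leftDividesʳ)

  conj : Carrier → Carrier → Carrier
  conj g x = g ∙ x ∙ g ⁻¹

  module Conjugation where
    open import Relation.Binary.Reasoning.Setoid setoid

    conj-cong : ∀ {g h x y} → g ≈ h → x ≈ y → conj g x ≈ conj h y
    conj-cong g≈h x≈y = ∙-cong (∙-cong g≈h x≈y) (⁻¹-cong g≈h)

    conj-homo-∙ : ∀ g x y → conj g (x ∙ y) ≈ conj g x ∙ conj g y
    conj-homo-∙ g x y = sym (begin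
      (g ∙ x ∙ g ⁻¹) ∙ (g ∙ y ∙ g ⁻¹)   ≈⟨ assoc _ _ _ ⟩
      (g ∙ x) ∙ (g ⁻¹ ∙ (g ∙ y ∙ g ⁻¹)) ≈⟨ ∙-congˡ (sym (assoc _ _ _)) ⟩
      (g ∙ x) ∙ (g ⁻¹ ∙ (g ∙ y) ∙ g ⁻¹) ≈⟨ ∙-congˡ (∙-congʳ (\\-leftDividesʳ g y)) ⟩
      (g ∙ x) ∙ (y ∙ g ⁻¹)              ≈⟨ sym (assoc _ _ _) ⟩
      g ∙ x ∙ y ∙ g ⁻¹                  ≈⟨ ∙-congʳ (assoc _ _ _) ⟩
      g ∙ (x ∙ y) ∙ g ⁻¹                ∎)

    conj-homo-⁻¹ : ∀ g x → conj g (x ⁻¹) ≈ conj g x ⁻¹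
    conj-homo-⁻¹ g x = sym (begin
      (g ∙ x ∙ g ⁻¹) ⁻¹      ≈⟨ ⁻¹-anti-homo-∙ _ _ ⟩
      g ⁻¹ ⁻¹ ∙ (g ∙ x) ⁻¹   ≈⟨ ∙-cong (⁻¹-involutive g) (⁻¹-anti-homo-∙ g x) ⟩
      g ∙ (x ⁻¹ ∙ g ⁻¹)      ≈⟨ sym (assoc _ _ _) ⟩
      g ∙ x ⁻¹ ∙ g ⁻¹        ∎)

    conj-∙ : ∀ h g x → conj h (conj g x) ≈ conj (h ∙ g) x
    conj-∙ h g x = begin
      h ∙ (g ∙ x ∙ g ⁻¹) ∙ h ⁻¹       ≈⟨ ∙-congʳ (sym (assoc _ _ _)) ⟩
      h ∙ (g ∙ x) ∙ g ⁻¹ ∙ h ⁻¹       ≈⟨ ∙-congʳ (∙-congʳ (sym (assoc _ _ _))) ⟩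
      h ∙ g ∙ x ∙ g ⁻¹ ∙ h ⁻¹         ≈⟨ assoc _ _ _ ⟩
      (h ∙ g ∙ x) ∙ (g ⁻¹ ∙ h ⁻¹)     ≈⟨ ∙-congˡ (sym (⁻¹-anti-homo-∙ h g)) ⟩
      (h ∙ g ∙ x) ∙ (h ∙ g) ⁻¹        ∎

    conj-ε : ∀ x → conj ε x ≈ x
    conj-ε x = begin
      ε ∙ x ∙ ε ⁻¹  ≈⟨ ∙-cong (identityˡ x) ε⁻¹≈ε ⟩
      x ∙ ε         ≈⟨ identityʳ x ⟩
      x             ∎

    conj-inverseˡ : ∀ g x → conj (g ⁻¹) (conj g x) ≈ x
    conj-inverseˡ g x = trans (conj-∙ _ _ _) (trans (conj-cong (inverseˡ g) refl) (conj-ε x))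

    conj-inverseʳ : ∀ g x → conj g (conj (g ⁻¹) x) ≈ x
    conj-inverseʳ g x = trans (conj-∙ _ _ _) (trans (conj-cong (inverseʳ g) refl) (conj-ε x))

    ⁻¹∙-∙-≈conj : ∀ y x → y ⁻¹ ∙ x ∙ y ≈ conj (y ⁻¹) x
    ⁻¹∙-∙-≈conj y x = ∙-congˡ (sym (⁻¹-involutive y))

    conj-∙-shift : ∀ x y r → conj x y ∙ (x ∙ r) ≈ x ∙ (y ∙ r)
    conj-∙-shift x y r = begin
      (x ∙ y ∙ x ⁻¹) ∙ (x ∙ r)    ≈⟨ assoc _ _ _ ⟩
      (x ∙ y) ∙ (x ⁻¹ ∙ (x ∙ r))  ≈⟨ ∙-congˡ (\\-leftDividesʳ x r) ⟩
      (x ∙ y) ∙ r                 ≈⟨ assoc _ _ _ ⟩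
      x ∙ (y ∙ r)                 ∎

    ⁻¹∙conj-∙ : ∀ x y → x ⁻¹ ∙ conj x y ∙ x ≈ y
    ⁻¹∙conj-∙ x y = trans (⁻¹∙-∙-≈conj x (conj x y)) (conj-inverseˡ x y)

    conj-⁻¹∙-∙ : ∀ x y → conj y (y ⁻¹ ∙ x ∙ y) ≈ x
    conj-⁻¹∙-∙ x y = trans (conj-cong refl (⁻¹∙-∙-≈conj y x)) (conj-inverseʳ y x)

  open Conjugation

  Conjugate : Carrier → Carrier → Carrier → Set ℓ
  Conjugate g x y = y ≈ conj g x

  Conjugate-∙ : ∀ {g x x′ y y′} → Conjugate g x x′ → Conjugate g y y′ → Conjugate g (x ∙ y) (x′ ∙ y′)
  Conjugate-∙ x′≈ y′≈ = trans (∙-cong x′≈ y′≈) (sym (conj-homo-∙ _ _ _))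

  Conjugate-⁻¹ : ∀ {g x x′} → Conjugate g x x′ → Conjugate g (x ⁻¹) (x′ ⁻¹)
  Conjugate-⁻¹ x′≈ = trans (⁻¹-cong x′≈) (sym (conj-homo-⁻¹ _ _))

  InClass-conj : ∀ g {x c₀} → InClass x c₀ → InClass (conj g x) c₀
  InClass-conj g {c₀ = c₀} (h , x≈) = g ∙ h , trans (conj-cong refl x≈) (conj-∙ g h c₀)

  InClass-resp-≈ : ∀ {x y c₀} → x ≈ y → InClass x c₀ → InClass y c₀
  InClass-resp-≈ x≈y (h , x≈) = h , trans (sym x≈y) x≈

  actLetter-conjugate : ∀ {n g} k b {σ τ : Vec Carrier n} → Pointwise (Conjugate g) σ τ →
                        Pointwise (Conjugate g) (actLetter k b σ) (actLetter k b τ)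
  actLetter-conjugate zero    true  (ex ∷ ey ∷ rs) =
    Conjugate-∙ (Conjugate-∙ ex ey) (Conjugate-⁻¹ ex) ∷ ex ∷ rs
  actLetter-conjugate zero    false (ex ∷ ey ∷ rs) =
    ey ∷ Conjugate-∙ (Conjugate-∙ (Conjugate-⁻¹ ey) ex) ey ∷ rs
  actLetter-conjugate zero    true  []             = []
  actLetter-conjugate zero    false []             = []
  actLetter-conjugate zero    true  (ex ∷ [])      = ex ∷ []
  actLetter-conjugate zero    false (ex ∷ [])      = ex ∷ []
  actLetter-conjugate (suc k) b     []             = []
  actLetter-conjugate (suc k) b     (ex ∷ rs)      = ex ∷ actLetter-conjugate k b rs

  actLetter-InClass : ∀ {n} k b {σ cs : Vec Carrier n} → Pointwise InClass σ cs →
                      Pointwise InClass (actLetter k b σ) (swapAt k cs)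
  actLetter-InClass zero    true  (ex ∷ ey ∷ rs) = InClass-conj _ ey ∷ ex ∷ rs
  actLetter-InClass zero    false {x ∷ y ∷ _} (ex ∷ ey ∷ rs) =
    ey ∷ InClass-resp-≈ (sym (⁻¹∙-∙-≈conj y x)) (InClass-conj (y ⁻¹) ex) ∷ rs
  actLetter-InClass zero    true  []             = []
  actLetter-InClass zero    false []             = []
  actLetter-InClass zero    true  (ex ∷ [])      = ex ∷ []
  actLetter-InClass zero    false (ex ∷ [])      = ex ∷ []
  actLetter-InClass (suc k) b     []             = []
  actLetter-InClass (suc k) b     (ex ∷ rs)      = ex ∷ actLetter-InClass k b rs

  prod-actLetter : ∀ {n} k b (σ : Vec Carrier n) → prod (actLetter k b σ) ≈ prod σ
  prod-actLetter zero    true  (x ∷ y ∷ σ) = conj-∙-shift x y (prod σ)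
  prod-actLetter zero    false (x ∷ y ∷ σ) =
    trans (sym (conj-∙-shift y (y ⁻¹ ∙ x ∙ y) (prod σ))) (∙-congʳ (conj-⁻¹∙-∙ x y))
  prod-actLetter zero    true  []          = refl
  prod-actLetter zero    false []          = refl
  prod-actLetter zero    true  (x ∷ [])    = refl
  prod-actLetter zero    false (x ∷ [])    = refl
  prod-actLetter (suc k) b     []          = refl
  prod-actLetter (suc k) b     (x ∷ σ)     = ∙-congˡ (prod-actLetter k b σ)

  Gen-mono : ∀ {n} {σ τ : Vec Carrier n} {x} → (∀ p → Gen τ (lookup σ p)) → Gen σ x → Gen τ x
  Gen-mono σ⊆τ (gen-el p)   = σ⊆τ p
  Gen-mono σ⊆τ gen-ε        = gen-ε
  Gen-mono σ⊆τ (gen-∙ g h)  = gen-∙ (Gen-mono σ⊆τ g) (Gen-mono σ⊆τ h)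
  Gen-mono σ⊆τ (gen-⁻¹ g)   = gen-⁻¹ (Gen-mono σ⊆τ g)
  Gen-mono σ⊆τ (gen-≈ e g)  = gen-≈ e (Gen-mono σ⊆τ g)

  Gen-∷ : ∀ {n} {σ : Vec Carrier n} {x y} → Gen σ x → Gen (y ∷ σ) x
  Gen-∷ (gen-el p)  = gen-el (suc p)
  Gen-∷ gen-ε       = gen-ε
  Gen-∷ (gen-∙ g h) = gen-∙ (Gen-∷ g) (Gen-∷ h)
  Gen-∷ (gen-⁻¹ g)  = gen-⁻¹ (Gen-∷ g)
  Gen-∷ (gen-≈ e g) = gen-≈ e (Gen-∷ g)

  actLetter-generates : ∀ {n} k b (σ : Vec Carrier n) p → Gen (actLetter k b σ) (lookup σ p)
  actLetter-generates zero true (x ∷ y ∷ σ) zero = gen-el (suc zero)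
  actLetter-generates zero true (x ∷ y ∷ σ) (suc zero) =
    gen-≈ (⁻¹∙conj-∙ x y) (gen-∙ (gen-∙ (gen-⁻¹ (gen-el (suc zero))) (gen-el zero)) (gen-el (suc zero)))
  actLetter-generates zero false (x ∷ y ∷ σ) zero =
    gen-≈ (conj-⁻¹∙-∙ x y) (gen-∙ (gen-∙ (gen-el zero) (gen-el (suc zero))) (gen-⁻¹ (gen-el zero)))
  actLetter-generates zero false (x ∷ y ∷ σ) (suc zero) = gen-el zero
  actLetter-generates zero true  (x ∷ y ∷ σ) p@(suc (suc _)) = gen-el p
  actLetter-generates zero false (x ∷ y ∷ σ) p@(suc (suc _)) = gen-el p
  actLetter-generates zero true  (x ∷ [])    p = gen-el p
  actLetter-generates zero false (x ∷ [])    p = gen-el p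
  actLetter-generates (suc k) b  (x ∷ σ)     zero    = gen-el zero
  actLetter-generates (suc k) b  (x ∷ σ)     (suc p) = Gen-∷ (actLetter-generates k b σ p)

  actLetter-not-actLetter : ∀ {n} k b (σ : Vec Carrier n) →
                            Pointwise _≈_ (actLetter k (not b) (actLetter k b σ)) σ
  actLetter-not-actLetter zero    true  (x ∷ y ∷ σ) = refl ∷ ⁻¹∙conj-∙ x y ∷ Pointwise.refl refl
  actLetter-not-actLetter zero    false (x ∷ y ∷ σ) = conj-⁻¹∙-∙ x y ∷ refl ∷ Pointwise.refl refl
  actLetter-not-actLetter zero    true  []          = []
  actLetter-not-actLetter zero    false []          = []
  actLetter-not-actLetter zero    true  (x ∷ [])    = refl ∷ []
  actLetter-not-actLetter zero    false (x ∷ [])    = refl ∷ []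
  actLetter-not-actLetter (suc k) b     []          = []
  actLetter-not-actLetter (suc k) b     (x ∷ σ)     = refl ∷ actLetter-not-actLetter k b σ

  actLetter-actLetter-not : ∀ {n} k b (σ : Vec Carrier n) →
                            Pointwise _≈_ (actLetter k b (actLetter k (not b) σ)) σ
  actLetter-actLetter-not k true  = actLetter-not-actLetter k false
  actLetter-actLetter-not k false = actLetter-not-actLetter k true

  act-++ : ∀ {m} (u v : Word m) σ → act (u ++ v) σ ≡ act v (act u σ)
  act-++ []               v σ = ≡.refl
  act-++ (letter j b ∷ u) v σ = act-++ u v (actLetter (toℕ j) b σ)

  act-conjugate : ∀ {m g} (w : Word m) {σ τ} → Pointwise (Conjugate g) σ τ →
                  Pointwise (Conjugate g) (act w σ) (act w τ)
  act-conjugate []               σ∼τ = σ∼τ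
  act-conjugate (letter j b ∷ w) σ∼τ = act-conjugate w (actLetter-conjugate (toℕ j) b σ∼τ)

  act-InClass : ∀ {m} (w : Word m) {σ cs} → Pointwise InClass σ cs → Pointwise InClass (act w σ) (permute w cs)
  act-InClass []               σ∈cs = σ∈cs
  act-InClass (letter j b ∷ w) σ∈cs = act-InClass w (actLetter-InClass (toℕ j) b σ∈cs)

  prod-act : ∀ {m} (w : Word m) σ → prod (act w σ) ≈ prod σ
  prod-act []               σ = refl
  prod-act (letter j b ∷ w) σ = trans (prod-act w _) (prod-actLetter (toℕ j) b σ)

  act-generates : ∀ {m} (w : Word m) {σ} → (∀ x → Gen σ x) → ∀ x → Gen (act w σ) x
  act-generates []               σ-generates = σ-generates
  act-generates (letter j b ∷ w) σ-generates = act-generates w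
    (λ x → Gen-mono (actLetter-generates (toℕ j) b _) (σ-generates x))

  InΣ-act : ∀ {m} (w : Word m) C σ → InΣ C σ → InΣ (permute w C) (act w σ)
  InΣ-act w C σ (classes , generates , product) =
      Pointwise.lookup (act-InClass w (Extensional.extensional⇒inductive (Extensional.ext classes)))
    , act-generates w generates
    , trans (prod-act w _) product

  InΣ-act-fixing : ∀ {m} (w : Word m) C σ → permute w C ≡ C → InΣ C σ → InΣ C (act w σ)
  InΣ-act-fixing w C σ w-fixes-C σ∈Σ = ≡.subst (λ C′ → InΣ C′ (act w σ)) w-fixes-C (InΣ-act w C σ σ∈Σ)

  InΣ⇒InΣsy : ∀ {m} (C σ : Vec Carrier m) → InΣ C σ → InΣsy C σ
  InΣ⇒InΣsy C σ (classes , generates , product) = Permutation.id , classes , generates , product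

  Conjugate-refl : ∀ {x} → Conjugate ε x x
  Conjugate-refl = sym (conj-ε _)

  Conjugate-sym : ∀ {g x y} → Conjugate g x y → Conjugate (g ⁻¹) y x
  Conjugate-sym {g} y≈ = sym (trans (conj-cong refl y≈) (conj-inverseˡ g _))

  Conjugate-trans : ∀ {g h x y z} → Conjugate g x y → Conjugate h y z → Conjugate (h ∙ g) x z
  Conjugate-trans {g} {h} y≈ z≈ = trans z≈ (trans (conj-cong refl y≈) (conj-∙ h g _))

  -- The relation _~_ with the pointwise condition stated inductively, so that Agda can infer the tuples.
  _≃_ : ∀ {n} → Vec Carrier n → Vec Carrier n → Set (c ⊔ ℓ)
  σ ≃ τ = ∃ λ g → Pointwise (Conjugate g) σ τ

  ≃⇒~ : ∀ {n} {σ τ : Vec Carrier n} → σ ≃ τ → σ ~ τ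
  ≃⇒~ (g , σ∼τ) = g , Pointwise.lookup σ∼τ

  ~⇒≃ : ∀ {n} {σ τ : Vec Carrier n} → σ ~ τ → σ ≃ τ
  ~⇒≃ (g , σ∼τ) = g , Extensional.extensional⇒inductive (Extensional.ext σ∼τ)

  ≃-refl : ∀ {n} {σ : Vec Carrier n} → σ ≃ σ
  ≃-refl = ε , Pointwise.refl Conjugate-refl

  ≃-sym : ∀ {n} {σ τ : Vec Carrier n} → σ ≃ τ → τ ≃ σ
  ≃-sym (g , σ∼τ) = g ⁻¹ , Pointwise.sym Conjugate-sym σ∼τ

  ≃-trans : ∀ {n} {σ τ υ : Vec Carrier n} → σ ≃ τ → τ ≃ υ → σ ≃ υ
  ≃-trans (g , σ∼τ) (h , τ∼υ) = h ∙ g , Pointwise.trans Conjugate-trans σ∼τ τ∼υ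

  ≃-setoid : ℕ → Setoid c (c ⊔ ℓ)
  ≃-setoid n = record
    { Carrier       = Vec Carrier n
    ; _≈_           = _≃_
    ; isEquivalence = record { refl = ≃-refl ; sym = ≃-sym ; trans = ≃-trans }
    }

  module ≃-Reasoning {n} = SetoidReasoning (≃-setoid n)

  Pointwise-≈⇒≃ : ∀ {n} {σ τ : Vec Carrier n} → Pointwise _≈_ σ τ → σ ≃ τ
  Pointwise-≈⇒≃ σ≈τ = ε , Pointwise.map (λ x≈y → trans (sym x≈y) Conjugate-refl) σ≈τ

  act-resp-≃ : ∀ {m} (w : Word m) {σ τ} → σ ≃ τ → act w σ ≃ act w τ
  act-resp-≃ w (g , σ∼τ) = g , act-conjugate w σ∼τ

  act-invWord-act : ∀ {m} (w : Word m) σ → act (invWord w) (act w σ) ≃ σ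
  act-invWord-act []                 σ = ≃-refl
  act-invWord-act {m} (l@(letter j b) ∷ w) σ = begin
    act (invWord (l ∷ w)) (act w τ)
      ≡⟨ ≡.cong (λ u → act u (act w τ)) (invWord-∷ l w) ⟩
    act (invWord w ++ invLetter l ∷ []) (act w τ)
      ≡⟨ act-++ (invWord w) (invLetter l ∷ []) (act w τ) ⟩
    actLetter (toℕ j) (not b) (act (invWord w) (act w τ))
      ≈⟨ act-resp-≃ (invLetter l ∷ []) (act-invWord-act w τ) ⟩
    actLetter (toℕ j) (not b) τ
      ≈⟨ Pointwise-≈⇒≃ (actLetter-not-actLetter (toℕ j) b σ) ⟩
    σ ∎
    where
    open ≃-Reasoning
    τ : Vec Carrier m
    τ = actLetter (toℕ j) b σ

  act-act-invWord : ∀ {m} (w : Word m) σ → act w (act (invWord w) σ) ≃ σ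
  act-act-invWord []                 σ = ≃-refl
  act-act-invWord {m} (l@(letter j b) ∷ w) σ = begin
    act w (actLetter (toℕ j) b (act (invWord (l ∷ w)) σ))
      ≡⟨ ≡.cong (λ u → act w (actLetter (toℕ j) b (act u σ))) (invWord-∷ l w) ⟩
    act w (actLetter (toℕ j) b (act (invWord w ++ invLetter l ∷ []) σ))
      ≡⟨ ≡.cong (λ τ → act w (actLetter (toℕ j) b τ)) (act-++ (invWord w) (invLetter l ∷ []) σ) ⟩
    act w (actLetter (toℕ j) b (actLetter (toℕ j) (not b) τ))
      ≈⟨ act-resp-≃ w (Pointwise-≈⇒≃ (actLetter-actLetter-not (toℕ j) b τ)) ⟩
    act w τ
      ≈⟨ act-act-invWord w σ ⟩
    σ ∎
    where
    open ≃-Reasoning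
    τ : Vec Carrier m
    τ = act (invWord w) σ

  Commutes : ∀ {f m} → Subgroup f m → Word m → Vec Carrier m → Set (c ⊔ ℓ ⊔ f)
  Commutes F p σ = ∀ φ → Subgroup.Mem F φ → act (p ++ φ) σ ~ act (φ ++ p) σ

  module _ {f m} (F : Subgroup f m) where
    open ≃-Reasoning

    Fixed-resp-≃ : ∀ {σ τ} → σ ≃ τ → Fixed F σ → Fixed F τ
    Fixed-resp-≃ {σ} {τ} σ≃τ fixed φ φ∈F = ≃⇒~ (begin
      act φ τ  ≈⟨ act-resp-≃ φ (≃-sym σ≃τ) ⟩
      act φ σ  ≈⟨ ~⇒≃ (fixed φ φ∈F) ⟩
      σ        ≈⟨ σ≃τ ⟩
      τ        ∎)

    Fixed-act : ∀ p σ → Commutes F p σ → Fixed F σ → Fixed F (act p σ)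
    Fixed-act p σ commutes fixed φ φ∈F = ≃⇒~ (begin
      act φ (act p σ)  ≡⟨ act-++ p φ σ ⟨
      act (p ++ φ) σ   ≈⟨ ~⇒≃ (commutes φ φ∈F) ⟩
      act (φ ++ p) σ   ≡⟨ act-++ φ p σ ⟩
      act p (act φ σ)  ≈⟨ act-resp-≃ p (~⇒≃ (fixed φ φ∈F)) ⟩
      act p σ          ∎)

    Fixed-act⁻ : ∀ p τ → Commutes F p τ → Fixed F (act p τ) → Fixed F τ
    Fixed-act⁻ p τ commutes fixed φ φ∈F = ≃⇒~ (begin
      act φ τ                              ≈⟨ act-invWord-act p (act φ τ) ⟨
      act (invWord p) (act p (act φ τ))    ≈⟨ act-resp-≃ (invWord p) p-cancels ⟩
      act (invWord p) (act p τ)            ≈⟨ act-invWord-act p τ ⟩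
      τ                                    ∎)
      where
      p-cancels : act p (act φ τ) ≃ act p τ
      p-cancels = begin
        act p (act φ τ)  ≡⟨ act-++ φ p τ ⟨
        act (φ ++ p) τ   ≈⟨ ~⇒≃ (commutes φ φ∈F) ⟨
        act (p ++ φ) τ   ≡⟨ act-++ p φ τ ⟩
        act φ (act p τ)  ≈⟨ ~⇒≃ (fixed φ φ∈F) ⟩
        act p τ          ∎

  module _ {f m} {C : Vec Carrier m} {F : Subgroup f m}
           (commutes : ∀ (i j : Fin m) → i < j → ∀ σ → InΣsy C σ → Commutes F (pureWord i j) σ) where

    Invariant : Vec Carrier m → Set (c ⊔ ℓ ⊔ f)
    Invariant σ = InΣ C σ × Fixed F σ

    pureWord-invariant : ∀ {i j} → i < j → ∀ σ → Invariant σ → Invariant (act (pureWord i j) σ)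
    pureWord-invariant {i} {j} i<j σ (σ∈Σ , fixed) =
        InΣ-act-fixing p C σ (permute-pureWord i j C) σ∈Σ
      , Fixed-act F p σ (commutes i j i<j σ (InΣ⇒InΣsy C σ σ∈Σ)) fixed
      where
      p : Word m
      p = pureWord i j

    invPureWord-invariant : ∀ {i j} → i < j → ∀ σ → Invariant σ → Invariant (act (invWord (pureWord i j)) σ)
    invPureWord-invariant {i} {j} i<j σ (σ∈Σ , fixed) =
        τ∈Σ
      , Fixed-act⁻ F p τ (commutes i j i<j τ (InΣ⇒InΣsy C τ τ∈Σ))
                   (Fixed-resp-≃ F (≃-sym (act-act-invWord p σ)) fixed)
      where
      p : Word m
      p = pureWord i j
      τ : Vec Carrier m
      τ = act (invWord p) σ
      p⁻¹-fixes-C : permute (invWord p) C ≡ C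
      p⁻¹-fixes-C = ≡.trans (≡.cong (permute (invWord p)) (≡.sym (permute-pureWord i j C)))
                            (permute-invWord p C)
      τ∈Σ : InΣ C τ
      τ∈Σ = InΣ-act-fixing (invWord p) C σ p⁻¹-fixes-C σ∈Σ

    InB-invariant : ∀ {b} → InB b → ∀ σ → Invariant σ → Invariant (act b σ)
    InB-invariant B-ε σ inv = inv
    InB-invariant (B-gen i j {w} i<j b∈B) σ inv =
      ≡.subst Invariant (≡.sym (act-++ (pureWord i j) w σ))
        (InB-invariant b∈B _ (pureWord-invariant i<j σ inv))
    InB-invariant (B-inv i j {w} i<j b∈B) σ inv =
      ≡.subst Invariant (≡.sym (act-++ (invWord (pureWord i j)) w σ))
        (InB-invariant b∈B _ (invPureWord-invariant i<j σ inv))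

open HurwitzAction using (InB-invariant)

proposition6 : ∀ {c ℓ f : Level} (G : Group c ℓ) → let open GroupDefs G in
    Finite →
    (m : ℕ) (C : Vec (Group.Carrier G) m) (F : Subgroup f m) →
    (∀ (i j : Fin m) → i < j → ∀ φ → Subgroup.Mem F φ →
       ∀ σ → InΣsy C σ → act (pureWord i j ++ φ) σ ~ act (φ ++ pureWord i j) σ) →
    ∀ b → InB b → ∀ σ → InΣ C σ → Fixed F σ →
    InΣ C (act b σ) × Fixed F (act b σ)
proposition6 G _ m C F commutes b b∈B σ σ∈Σ fixed =
  InB-invariant G {C = C} {F} (λ i j i<j σ σ∈Σ φ φ∈F → commutes i j i<j φ φ∈F σ σ∈Σ)
    b∈B σ (σ∈Σ , fixed)
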